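{- Let $T$ be a rooted tree with vertex weights $w_i\ge 0$, vertex costs $s_i$ and threshold $w_0$ (with $w_i\le w_0$ for all $i$), and let $v$ be a vertex. For each $x\in\mathsf{win}^*_v$ let $H_x=\{x\}\cup\{i\in\mathsf{win}^-_v:\mathsf{next}_v(i)=x\}$ and let $i_x$ be an element of $H_x$ minimizing $\mathsf{cost}(x,\cdot)$ over $H_x$. Let $a$ be an element of $\{i_x: x\in\mathsf{win}^*_v\}$ minimizing $\mathsf{cost}(v,\cdot)$ over this set. Then $a$ minimizes $\mathsf{cost}(v,i)$ over all $i\in\mathsf{win}_v$; that is, $\mathsf{cost}(v,a)=\min_{i\in\mathsf{win}_v}\mathsf{cost}(v,i)$, which is the minimum cost of a chain partition of $T_v$.
   Context: $T_v$ is the subtree rooted at $v$. For $u\in T_v$, $T[v,u]$ is the set of vertices on the path from $v$ to $u$, and $T[v,u)$ is $T[v,u]\setminus\{u\}$. A chain is a set of the form $T[v,u]$; a chain partition of $T_v$ is a partition of its vertex set into chains each of total weight $\sum w_j\le w_0$, and its cost is the sum over its chains of the maximum $s_j$ in the chain. The window $\mathsf{win}_v$ is the set of $u\in T_v$ with $\sum_{j\in T[v,u]}w_j\le w_0$. A vertex $u\in T_v$ is s-maximal (in $T_v$) if $s_p<s_u$ for every $p\in T[v,u)$. For $u\in T_v$, $u\neq v$, $\mathsf{next}_v(u)$ is the closest proper ancestor of $u$ in $T_v$ that is s-maximal in $T_v$. $\mathsf{win}^*_v$ is the set of s-maximal vertices of $\mathsf{win}_v$ and $\mathsf{win}^-_v=\mathsf{win}_v\setminus\mathsf{win}^*_v$.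 For $i\in\mathsf{win}_v$, $\mathsf{cost}(v,i)$ is the minimum cost of a chain partition of $T_v$ one of whose chains is $T[v,i]$ (for $x\in\mathsf{win}^*_v$ and $i\in H_x$ one has $i\in\mathsf{win}_x$, so $\mathsf{cost}(x,i)$ is defined). -}

module Defs where

open import Data.Rational using (ℚ; _≤_; _<_; _+_; _⊔_; 0ℚ)
open import Data.List using (List; []; _∷_; map; foldr; length; lookup)
open import Data.List.Membership.Propositional using (_∈_)
open import Data.List.Relation.Unary.All using (All)
open import Data.List.Relation.Unary.Any using (Any)
open import Data.Fin using (Fin)
open import Data.Product using (Σ; _×_; _,_)
open import Data.Sum using (_⊎_)
open import Relation.Binary.PropositionalEquality using (_≡_)
open import Relation.Nullary using (¬_)

data Tree : Set where
  node : (w s : ℚ) → (children : List Tree) → Tree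

-- Vertices of a tree, as positions (paths from the root).
data Pos : Tree → Set where
  here  : ∀ {w s ts} → Pos (node w s ts)
  there : ∀ {w s ts t} → t ∈ ts → Pos t → Pos (node w s ts)

weightAt : ∀ {t} → Pos t → ℚ
weightAt {node w s ts} here = w
weightAt (there _ p) = weightAt p

costAt : ∀ {t} → Pos t → ℚ
costAt {node w s ts} here = s
costAt (there _ p) = costAt p

-- x ≼ y : x is an ancestor of y or equal to y (so y ∈ T_x).
data _≼_ : ∀ {t} → Pos t → Pos t → Set where
  h≼ : ∀ {w s ts} {p : Pos (node w s ts)} → here ≼ p
  t≼ : ∀ {w s ts t} {m : t ∈ ts} {p q : Pos t} → p ≼ q
       → _≼_ {node w s ts} (there m p) (there m q)

ancP : ∀ {t} → Pos t → List (Pos t)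
ancP here = []
ancP (there m p) = here ∷ map (there m) (ancP p)

anc : ∀ {t} → Pos t → List (Pos t)
anc here = here ∷ []
anc (there m p) = here ∷ map (there m) (anc p)

path : ∀ {t} {x y : Pos t} → x ≼ y → List (Pos t)
path (h≼ {p = p}) = anc p
path (t≼ {m = m} pr) = map (there m) (path pr)

pathP : ∀ {t} {x y : Pos t} → x ≼ y → List (Pos t)
pathP (h≼ {p = p}) = ancP p
pathP (t≼ {m = m} pr) = map (there m) (pathP pr)

sumℚ : List ℚ → ℚ
sumℚ = foldr _+_ 0ℚ

module _ {t : Tree} (w₀ : ℚ) where

  InWin : Pos t → Pos t → Set
  InWin v u = Σ (v ≼ u) λ pr → sumℚ (map weightAt (path pr)) ≤ w₀

  SMax : Pos t → Pos t → Set
  SMax v u = Σ (v ≼ u) λ pr → ∀ p → p ∈ pathP pr → costAt p < costAt u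

  IsNext : Pos t → Pos t → Pos t → Set
  IsNext v u x = Σ (v ≼ u) λ pr →
    (x ∈ pathP pr) × SMax v x × (∀ y → y ∈ pathP pr → SMax v y → y ≼ x)

  InWinStar : Pos t → Pos t → Set
  InWinStar v u = InWin v u × SMax v u

  InWinMinus : Pos t → Pos t → Set
  InWinMinus v u = InWin v u × ¬ SMax v u

  InH : Pos t → Pos t → Pos t → Set
  InH v x i = (i ≡ x) ⊎ (InWinMinus v i × IsNext v i x)

  record Chain (x : Pos t) : Set where
    constructor chain
    field
      top  : Pos t
      bot  : Pos t
      below : x ≼ top
      ord  : top ≼ bot

  open Chain public

  verts : ∀ {x} → Chain x → List (Pos t)
  verts c = path (ord c)

  chainWeight : ∀ {x} → Chain x → ℚ
  chainWeight c = sumℚ (map weightAt (verts c))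

  chainCost : ∀ {x} → Chain x → ℚ
  chainCost c = foldr _⊔_ (costAt (top c)) (map costAt (verts c))

  record ChainPartition (x : Pos t) : Set where
    field
      chains : List (Chain x)
      light  : All (λ c → chainWeight c ≤ w₀) chains
      exact  : ∀ u → x ≼ u →
        Σ (Fin (length chains)) λ k → (u ∈ verts (lookup chains k)) ×
          (∀ k′ → u ∈ verts (lookup chains k′) → k′ ≡ k)

  open ChainPartition public

  partitionCost : ∀ {x} → ChainPartition x → ℚ
  partitionCost P = sumℚ (map chainCost (chains P))

  HasChain : ∀ {x} → ChainPartition x → Pos t → Set
  HasChain {x} P i = Any (λ c → (top c ≡ x) × (bot c ≡ i)) (chains P)

  IsCost : Pos t → Pos t → ℚ → Set
  IsCost x i c =
    (Σ (ChainPartition x) λ P → HasChain P i × (partitionCost P ≡ c)) ×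
    (∀ (Q : ChainPartition x) → HasChain Q i → c ≤ partitionCost Q)

  IsMinPartitionCost : Pos t → ℚ → Set
  IsMinPartitionCost x c =
    (Σ (ChainPartition x) λ P → partitionCost P ≡ c) ×
    (∀ (Q : ChainPartition x) → c ≤ partitionCost Q)

module Submission where

-- Let i ∈ win_v, let x be i if i is s-maximal and next_v(i) otherwise (so i ∈ H_x), and let j = i_x.
-- A chain partition of T_v containing T[v,i] consists of T[v,i], chains inside T_x and chains R
-- outside T_x. The chains inside T_x together with T[x,i] ⊆ T[v,i] partition T_x, so the partition
-- costs at least cost(x,i) + cost R. Conversely, lengthening the chain T[x,j] of an optimal partition
-- of T_x to T[v,j] and adding R partitions T_v; every vertex of T[v,x) is cheaper than the s-maximal
-- x, so cost(v,j) ≤ cost(x,j) + cost R. As cost(v,a) ≤ cost(v,j) and cost(x,j) ≤ cost(x,i), we get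
-- cost(v,a) ≤ cost(v,i); and every chain partition of T_v contains some T[v,i] with i ∈ win_v.
-- The costs exist since every decidable vertex set has an optimal partition, built by recursion on
-- its size around a topmost vertex.

open import Algebra.Bundles using (CommutativeMonoid)
open import Data.Fin using (Fin; zero; suc)
import Data.Fin.Properties as Finₚ
open import Data.List using (List; []; _∷_; _++_; map; foldr; length; lookup; filter)
import Data.List.Extrema
open import Data.List.Membership.Propositional using (_∈_; find; lose)
open import Data.List.Membership.Propositional.Properties
  using (∈-lookup; ∈-∃++; ∈-map⁺; ∈-map⁻; ∈-++⁺ˡ; ∈-++⁺ʳ)
open import Data.List.Properties using (map-++; map-∘)
open import Data.List.Relation.Unary.All as All using (All; []; _∷_)
import Data.List.Relation.Unary.All.Properties as Allₚ
open import Data.List.Relation.Unary.Any as Any using (Any; here; there)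
open import Data.List.Relation.Unary.Any.Properties using (lookup-index)
open import Data.Nat as ℕ using (ℕ; zero; suc; z≤n; s≤s)
import Data.Nat.Properties as ℕₚ
open import Data.Product using (Σ; Σ-syntax; ∃; ∃-syntax; _×_; _,_; proj₁; proj₂)
open import Data.Rational using (ℚ; _≤_; _+_; _⊔_; 0ℚ)
import Data.Rational.Properties as ℚₚ
open import Algebra.Properties.CommutativeSemigroup
  (CommutativeMonoid.commutativeSemigroup ℚₚ.+-0-commutativeMonoid) using (x∙yz≈y∙xz)
open import Data.Sum using (_⊎_; inj₁; inj₂; [_,_]′)
open import Defs
open import Function using (_∘_)
open import Level using (0ℓ)
open import Relation.Binary.Bundles using (DecTotalOrder)
open import Relation.Binary.PropositionalEquality
open import Relation.Nullary using (¬_; Dec; yes; no; contradiction)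
import Relation.Nullary.Decidable as Dec
open import Relation.Unary using (Pred; Decidable; _⊆_; _≐_; _∩_; _∪_; ∁; Empty)
open import Relation.Unary.Properties using (∁?)

module _ {A : Set} where

  data ExactlyOne (P : Pred A 0ℓ) : List A → Set where
    hit  : ∀ {x xs} → P x → All (∁ P) xs → ExactlyOne P (x ∷ xs)
    miss : ∀ {x xs} → ¬ P x → ExactlyOne P xs → ExactlyOne P (x ∷ xs)

  UniqueIndex : Pred A 0ℓ → List A → Set
  UniqueIndex P xs =
    Σ[ k ∈ Fin (length xs) ] P (lookup xs k) × (∀ k′ → P (lookup xs k′) → k′ ≡ k)

  All-remove : ∀ {P : Pred A 0ℓ} xs {y ys} → All P (xs ++ y ∷ ys) → All P (xs ++ ys)
  All-remove xs a = Allₚ.++⁺ (Allₚ.++⁻ˡ xs a) (All.tail (Allₚ.++⁻ʳ xs a))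

  module _ {P : Pred A 0ℓ} where

    exactlyOne⇒Any : ∀ {xs} → ExactlyOne P xs → Any P xs
    exactlyOne⇒Any (hit p _)  = here p
    exactlyOne⇒Any (miss _ o) = there (exactlyOne⇒Any o)

    exactlyOne-++⁺ˡ : ∀ {xs ys} → ExactlyOne P xs → All (∁ P) ys → ExactlyOne P (xs ++ ys)
    exactlyOne-++⁺ˡ (hit p a)  b = hit p (Allₚ.++⁺ a b)
    exactlyOne-++⁺ˡ (miss n o) b = miss n (exactlyOne-++⁺ˡ o b)

    exactlyOne-++⁺ʳ : ∀ {xs ys} → All (∁ P) xs → ExactlyOne P ys → ExactlyOne P (xs ++ ys)
    exactlyOne-++⁺ʳ []      o = o
    exactlyOne-++⁺ʳ (n ∷ a) o = miss n (exactlyOne-++⁺ʳ a o)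

    exactlyOne-others : ∀ xs {y ys} → ExactlyOne P (xs ++ y ∷ ys) → P y → All (∁ P) (xs ++ ys)
    exactlyOne-others []       (hit _ a)  _  = a
    exactlyOne-others []       (miss n _) py = contradiction py n
    exactlyOne-others (x ∷ xs) (hit _ a)  py = contradiction py (All.lookup a (∈-++⁺ʳ xs (here refl)))
    exactlyOne-others (x ∷ xs) (miss n o) py = n ∷ exactlyOne-others xs o py

    exactlyOne-remove : ∀ xs {y ys} → ExactlyOne P (xs ++ y ∷ ys) → ¬ P y → ExactlyOne P (xs ++ ys)
    exactlyOne-remove []       (hit p _)  n = contradiction p n
    exactlyOne-remove []       (miss _ o) _ = o
    exactlyOne-remove (x ∷ xs) (hit p a)  _ = hit p (All-remove xs a)
    exactlyOne-remove (x ∷ xs) (miss m o) n = miss m (exactlyOne-remove xs o n)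

    exactlyOne-map : ∀ {Q : Pred A 0ℓ} {xs} → P ⊆ Q → Q ⊆ P → ExactlyOne P xs → ExactlyOne Q xs
    exactlyOne-map f g (hit p a)  = hit (f p) (All.map (_∘ g) a)
    exactlyOne-map f g (miss n o) = miss (n ∘ g) (exactlyOne-map f g o)

    exactlyOne-filter⁺ : ∀ {G : Pred A 0ℓ} (G? : Decidable G) {xs} →
      All (λ x → P x → G x) xs → ExactlyOne P xs → ExactlyOne P (filter G? xs)
    exactlyOne-filter⁺ G? {x ∷ _} (g ∷ _) (hit p a) with G? x
    ... | yes _ = hit p (Allₚ.filter⁺ G? a)
    ... | no ¬g = contradiction (g p) ¬g
    exactlyOne-filter⁺ G? {x ∷ _} (_ ∷ gs) (miss n o) with G? x
    ... | yes _ = miss n (exactlyOne-filter⁺ G? gs o)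
    ... | no _  = exactlyOne-filter⁺ G? gs o

    exactlyOne⇒uniqueIndex : ∀ {xs} → ExactlyOne P xs → UniqueIndex P xs
    exactlyOne⇒uniqueIndex (hit p a) = zero , p , λ
      { zero _ → refl
      ; (suc k) q → contradiction q (All.lookup a (∈-lookup k)) }
    exactlyOne⇒uniqueIndex (miss n o) with k , p , u ← exactlyOne⇒uniqueIndex o =
      suc k , p , λ
      { zero q → contradiction q n
      ; (suc k′) q → cong suc (u k′ q) }

    uniqueIndex⇒exactlyOne : ∀ xs → UniqueIndex P xs → ExactlyOne P xs
    uniqueIndex⇒exactlyOne (x ∷ xs) (zero , p , u) =
      hit p (Allₚ.¬Any⇒All¬ xs λ a → Finₚ.0≢1+n (sym (u (suc (Any.index a)) (lookup-index a))))
    uniqueIndex⇒exactlyOne (x ∷ xs) (suc k , p , u) =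
      miss (λ q → Finₚ.0≢1+n (u zero q))
        (uniqueIndex⇒exactlyOne xs (k , p , λ k′ q → Finₚ.suc-injective (u (suc k′) q)))

  witnesses : {P : Pred A 0ℓ} → Decidable P → List A → List (Σ A P)
  witnesses P? [] = []
  witnesses P? (x ∷ xs) with P? x
  ... | yes p = (x , p) ∷ witnesses P? xs
  ... | no _  = witnesses P? xs

  ∈-witnesses : ∀ {P : Pred A 0ℓ} (P? : Decidable P) {x xs} →
    x ∈ xs → P x → ∃[ p ] (x , p) ∈ witnesses P? xs
  ∈-witnesses P? {xs = y ∷ _} (here refl) px with P? y
  ... | yes p = p , here refl
  ... | no ¬p = contradiction px ¬p
  ∈-witnesses P? {xs = y ∷ _} (there m) px with P? y
  ... | yes _ = let p , m′ = ∈-witnesses P? m px in p , there m′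
  ... | no _  = ∈-witnesses P? m px

  module _ {P Q : Pred A 0ℓ} (P? : Decidable P) (Q? : Decidable Q) (Q⊆P : Q ⊆ P) where

    length-filter-mono : ∀ xs → length (filter Q? xs) ℕ.≤ length (filter P? xs)
    length-filter-mono [] = z≤n
    length-filter-mono (x ∷ xs) with P? x | Q? x
    ... | yes _ | yes _ = s≤s (length-filter-mono xs)
    ... | yes _ | no _  = ℕₚ.m≤n⇒m≤1+n (length-filter-mono xs)
    ... | no ¬p | yes q = contradiction (Q⊆P q) ¬p
    ... | no _  | no _  = length-filter-mono xs

    length-filter-< : ∀ {x} xs → x ∈ xs → P x → ¬ Q x →
      length (filter Q? xs) ℕ.< length (filter P? xs)
    length-filter-< (y ∷ xs) (here refl) p ¬q with P? y | Q? y
    ... | _     | yes q = contradiction q ¬q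
    ... | no ¬p | _     = contradiction p ¬p
    ... | yes _ | no _  = s≤s (length-filter-mono xs)
    length-filter-< (y ∷ xs) (there m) p ¬q with P? y | Q? y
    ... | yes _ | yes _ = s≤s (length-filter-< xs m p ¬q)
    ... | yes _ | no _  = ℕₚ.m≤n⇒m≤1+n (length-filter-< xs m p ¬q)
    ... | no ¬p | yes q = contradiction (Q⊆P q) ¬p
    ... | no _  | no _  = length-filter-< xs m p ¬q

exactlyOne-map⁺ : ∀ {A B : Set} {P : Pred B 0ℓ} (f : A → B) {xs} →
  ExactlyOne (P ∘ f) xs → ExactlyOne P (map f xs)
exactlyOne-map⁺ f (hit p a)  = hit p (Allₚ.map⁺ a)
exactlyOne-map⁺ f (miss n o) = miss n (exactlyOne-map⁺ f o)

exactlyOne-map⁻ : ∀ {A B : Set} {P : Pred B 0ℓ} (f : A → B) {xs} →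
  ExactlyOne P (map f xs) → ExactlyOne (P ∘ f) xs
exactlyOne-map⁻ f {_ ∷ _} (hit p a)  = hit p (Allₚ.map⁻ a)
exactlyOne-map⁻ f {_ ∷ _} (miss n o) = miss n (exactlyOne-map⁻ f o)

sumℚ-++ : ∀ xs ys → sumℚ (xs ++ ys) ≡ sumℚ xs + sumℚ ys
sumℚ-++ []       ys = sym (ℚₚ.+-identityˡ _)
sumℚ-++ (x ∷ xs) ys = trans (cong (x +_) (sumℚ-++ xs ys)) (sym (ℚₚ.+-assoc x _ _))

sumℚ-middle : ∀ xs y ys → sumℚ (xs ++ y ∷ ys) ≡ y + sumℚ (xs ++ ys)
sumℚ-middle []       y ys = refl
sumℚ-middle (x ∷ xs) y ys = trans (cong (x +_) (sumℚ-middle xs y ys)) (x∙yz≈y∙xz x y _)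

sumℚ-filter : ∀ {A : Set} {G : Pred A 0ℓ} (G? : Decidable G) (f : A → ℚ) xs →
  sumℚ (map f xs) ≡ sumℚ (map f (filter G? xs)) + sumℚ (map f (filter (∁? G?) xs))
sumℚ-filter G? f [] = sym (ℚₚ.+-identityˡ 0ℚ)
sumℚ-filter G? f (x ∷ xs) with G? x
... | yes _ = trans (cong (f x +_) (sumℚ-filter G? f xs))
  (sym (ℚₚ.+-assoc (f x) (sumℚ (map f (filter G? xs))) _))
... | no _  = trans (cong (f x +_) (sumℚ-filter G? f xs))
  (x∙yz≈y∙xz (f x) (sumℚ (map f (filter G? xs))) _)

sumℚ-nonneg : ∀ {xs} → All (0ℚ ≤_) xs → 0ℚ ≤ sumℚ xs
sumℚ-nonneg []       = ℚₚ.≤-refl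
sumℚ-nonneg (p ∷ ps) = ℚₚ.+-mono-≤ p (sumℚ-nonneg ps)

∈⇒≤sumℚ : ∀ {x xs} → All (0ℚ ≤_) xs → x ∈ xs → x ≤ sumℚ xs
∈⇒≤sumℚ {x} {_ ∷ ys} (_ ∷ ps) (here refl) =
  subst (_≤ x + sumℚ ys) (ℚₚ.+-identityʳ x) (ℚₚ.+-monoʳ-≤ x (sumℚ-nonneg ps))
∈⇒≤sumℚ {xs = y ∷ ys} (p ∷ ps) (there m) = ℚₚ.≤-trans (∈⇒≤sumℚ ps m)
  (subst (_≤ y + sumℚ ys) (ℚₚ.+-identityˡ (sumℚ ys)) (ℚₚ.+-monoˡ-≤ (sumℚ ys) p))

∈⇒≤foldr-⊔ : ∀ {e x xs} → x ∈ xs → x ≤ foldr _⊔_ e xs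
∈⇒≤foldr-⊔ {e} {xs = x ∷ xs} (here refl) = ℚₚ.p≤p⊔q x (foldr _⊔_ e xs)
∈⇒≤foldr-⊔ {e} {xs = y ∷ xs} (there m)   = ℚₚ.≤-trans (∈⇒≤foldr-⊔ m) (ℚₚ.p≤q⊔p y (foldr _⊔_ e xs))

foldr-⊔-lub : ∀ {e z} xs → e ≤ z → All (_≤ z) xs → foldr _⊔_ e xs ≤ z
foldr-⊔-lub []       e≤z []         = e≤z
foldr-⊔-lub (_ ∷ xs) e≤z (x≤z ∷ ps) = ℚₚ.⊔-lub x≤z (foldr-⊔-lub xs e≤z ps)

Subtree : ∀ {t} → Pos t → Pred (Pos t) 0ℓ
Subtree x = x ≼_

Between : ∀ {t} → Pos t → Pos t → Pred (Pos t) 0ℓ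
Between x y u = x ≼ u × u ≼ y

≼-irrelevant : ∀ {t} {x y : Pos t} (p q : x ≼ y) → p ≡ q
≼-irrelevant h≼     h≼     = refl
≼-irrelevant (t≼ p) (t≼ q) = cong t≼ (≼-irrelevant p q)

≼-refl : ∀ {t} {x : Pos t} → x ≼ x
≼-refl {x = here}      = h≼
≼-refl {x = there _ _} = t≼ ≼-refl

≼-trans : ∀ {t} {x y z : Pos t} → x ≼ y → y ≼ z → x ≼ z
≼-trans h≼     _      = h≼
≼-trans (t≼ p) (t≼ q) = t≼ (≼-trans p q)

≼-antisym : ∀ {t} {x y : Pos t} → x ≼ y → y ≼ x → x ≡ y
≼-antisym h≼     h≼     = refl
≼-antisym (t≼ p) (t≼ q) = cong (there _) (≼-antisym p q)

≼-comparable : ∀ {t} {x y u : Pos t} → x ≼ u → y ≼ u → x ≼ y ⊎ y ≼ x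
≼-comparable h≼     _      = inj₁ h≼
≼-comparable (t≼ _) h≼     = inj₂ h≼
≼-comparable (t≼ p) (t≼ q) with ≼-comparable p q
... | inj₁ r = inj₁ (t≼ r)
... | inj₂ r = inj₂ (t≼ r)

depth : ∀ {t} → Pos t → ℕ
depth here        = 0
depth (there _ p) = suc (depth p)

≼∧depth≥⇒≡ : ∀ {t} {x y : Pos t} → x ≼ y → depth y ℕ.≤ depth x → x ≡ y
≼∧depth≥⇒≡ {y = here}      h≼     _       = refl
≼∧depth≥⇒≡ {y = there _ _} h≼     ()
≼∧depth≥⇒≡                 (t≼ p) (s≤s q) = cong (there _) (≼∧depth≥⇒≡ p q)

mutual
  _≼?_ : ∀ {t} (x y : Pos t) → Dec (x ≼ y)
  here      ≼? _          = yes h≼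
  there _ _ ≼? here       = no λ ()
  there m p ≼? there m′ q = there-≼? m m′ p q

  there-≼? : ∀ {w s ts a b} (m : a ∈ ts) (m′ : b ∈ ts) (p : Pos a) (q : Pos b) →
    Dec (_≼_ {node w s ts} (there m p) (there m′ q))
  there-≼? (here refl) (here refl) p q = Dec.map′ t≼ (λ { (t≼ r) → r }) (p ≼? q)
  there-≼? (here refl) (there _)   _ _ = no λ ()
  there-≼? (there _)   (here refl) _ _ = no λ ()
  there-≼? {w} {s} (there m) (there m′) p q =
    Dec.map′ (λ { (t≼ r) → t≼ r }) (λ { (t≼ r) → t≼ r }) (there-≼? {w} {s} m m′ p q)

Between? : ∀ {t} (x y : Pos t) → Decidable (Between x y)
Between? x y u = (x ≼? u) Dec.×-dec (u ≼? y)

Rest : ∀ {t} → Pos t → Pos t → Pred (Pos t) 0ℓ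
Rest y j = Subtree y ∩ ∁ (Between y j)

Rest? : ∀ {t} (y j : Pos t) → Decidable (Rest y j)
Rest? y j u = (y ≼? u) Dec.×-dec Dec.¬? (Between? y j u)

mutual
  positions : (t : Tree) → List (Pos t)
  positions (node w s ts) = here ∷ positionsBelow ts (λ m → m)

  positionsBelow : ∀ {w s ts} (us : List Tree) → (∀ {u} → u ∈ us → u ∈ ts) →
    List (Pos (node w s ts))
  positionsBelow []       _ = []
  positionsBelow (u ∷ us) f =
    map (there (f (here refl))) (positions u) ++ positionsBelow us (λ m → f (there m))

mutual
  ∈-positions : ∀ {t} (p : Pos t) → p ∈ positions t
  ∈-positions here        = here refl
  ∈-positions (there m p) = there (∈-positionsBelow _ (λ m → m) m p)

  ∈-positionsBelow : ∀ {w s ts} us (f : ∀ {u} → u ∈ us → u ∈ ts) {u} (m : u ∈ us) (p : Pos u) →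
    there (f m) p ∈ positionsBelow {w} {s} us f
  ∈-positionsBelow (u ∷ us) f (here refl) p =
    ∈-++⁺ˡ (∈-map⁺ (there (f (here refl))) (∈-positions p))
  ∈-positionsBelow (u ∷ us) f (there m) p =
    ∈-++⁺ʳ (map (there (f (here refl))) (positions u)) (∈-positionsBelow us (λ m → f (there m)) m p)

∈-anc⁻ : ∀ {t} {u y : Pos t} → u ∈ anc y → u ≼ y
∈-anc⁻ {y = here}      (here refl) = h≼
∈-anc⁻ {y = there _ _} (here refl) = h≼
∈-anc⁻ {y = there _ _} (there e) with _ , e′ , refl ← ∈-map⁻ (there _) e = t≼ (∈-anc⁻ e′)

∈-anc⁺ : ∀ {t} {u y : Pos t} → u ≼ y → u ∈ anc y
∈-anc⁺ {y = here}      h≼     = here refl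
∈-anc⁺ {y = there _ _} h≼     = here refl
∈-anc⁺                 (t≼ r) = there (∈-map⁺ (there _) (∈-anc⁺ r))

∈-ancP⁻ : ∀ {t} {u y : Pos t} → u ∈ ancP y → u ≼ y × u ≢ y
∈-ancP⁻ {y = there _ _} (here refl) = h≼ , λ ()
∈-ancP⁻ {y = there _ _} (there e) with _ , e′ , refl ← ∈-map⁻ (there _) e =
  let u≼y , u≢y = ∈-ancP⁻ e′ in t≼ u≼y , λ { refl → u≢y refl }

∈-ancP⁺ : ∀ {t} {u y : Pos t} → u ≼ y → u ≢ y → u ∈ ancP y
∈-ancP⁺ {y = here}      h≼     u≢y = contradiction refl u≢y
∈-ancP⁺ {y = there _ _} h≼     _   = here refl
∈-ancP⁺                 (t≼ r) u≢y = there (∈-map⁺ (there _) (∈-ancP⁺ r λ { refl → u≢y refl }))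

∈-path⁻ : ∀ {t} {x y u : Pos t} (pr : x ≼ y) → u ∈ path pr → Between x y u
∈-path⁻ h≼ e = h≼ , ∈-anc⁻ e
∈-path⁻ (t≼ pr) e with _ , e′ , refl ← ∈-map⁻ (there _) e =
  let x≼u , u≼y = ∈-path⁻ pr e′ in t≼ x≼u , t≼ u≼y

∈-path⁺ : ∀ {t} {x y u : Pos t} (pr : x ≼ y) → Between x y u → u ∈ path pr
∈-path⁺ h≼      (_ , u≼y)          = ∈-anc⁺ u≼y
∈-path⁺ (t≼ pr) (t≼ x≼u , t≼ u≼y) = ∈-map⁺ (there _) (∈-path⁺ pr (x≼u , u≼y))

∈-pathP⁻ : ∀ {t} {x y u : Pos t} (pr : x ≼ y) → u ∈ pathP pr → Between x y u × u ≢ y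
∈-pathP⁻ h≼ e = (h≼ , proj₁ (∈-ancP⁻ e)) , proj₂ (∈-ancP⁻ e)
∈-pathP⁻ (t≼ pr) e with _ , e′ , refl ← ∈-map⁻ (there _) e =
  let (x≼u , u≼y) , u≢y = ∈-pathP⁻ pr e′ in (t≼ x≼u , t≼ u≼y) , λ { refl → u≢y refl }

∈-pathP⁺ : ∀ {t} {x y u : Pos t} (pr : x ≼ y) → Between x y u → u ≢ y → u ∈ pathP pr
∈-pathP⁺ h≼      (_ , u≼y)          u≢y = ∈-ancP⁺ u≼y u≢y
∈-pathP⁺ (t≼ pr) (t≼ x≼u , t≼ u≼y) u≢y =
  ∈-map⁺ (there _) (∈-pathP⁺ pr (x≼u , u≼y) λ { refl → u≢y refl })

anc-split : ∀ {t} {x y : Pos t} (q : x ≼ y) → anc y ≡ ancP x ++ path q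
anc-split h≼ = refl
anc-split {x = there m x} (t≼ q) = cong (here ∷_) (begin
  map (there m) (anc _)                   ≡⟨ cong (map (there m)) (anc-split q) ⟩
  map (there m) (ancP x ++ path q)         ≡⟨ map-++ (there m) (ancP x) (path q) ⟩
  map (there m) (ancP x) ++ path (t≼ q)   ∎)
  where open ≡-Reasoning

path-trans : ∀ {t} {x y z : Pos t} (p : x ≼ y) (q : y ≼ z) → path (≼-trans p q) ≡ pathP p ++ path q
path-trans h≼ q = anc-split q
path-trans (t≼ {m = m} p) (t≼ q) =
  trans (cong (map (there m)) (path-trans p q)) (map-++ (there m) (pathP p) (path q))

path-refl : ∀ {t} {x : Pos t} → path (≼-refl {x = x}) ≡ x ∷ []
path-refl {x = here}      = refl
path-refl {x = there m _} = cong (map (there m)) path-refl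

pathWeight : ∀ {t} {x y : Pos t} → x ≼ y → ℚ
pathWeight p = sumℚ (map weightAt (path p))

pathCost : ∀ {t} {x y : Pos t} → x ≼ y → ℚ
pathCost {x = x} p = foldr _⊔_ (costAt x) (map costAt (path p))

costAt≤pathCost : ∀ {t} {x y u : Pos t} (p : x ≼ y) → Between x y u → costAt u ≤ pathCost p
costAt≤pathCost p u∈p = ∈⇒≤foldr-⊔ (∈-map⁺ costAt (∈-path⁺ p u∈p))

pathCost-lub : ∀ {t} {x y : Pos t} {z} (p : x ≼ y) →
  (∀ {u} → Between x y u → costAt u ≤ z) → pathCost p ≤ z
pathCost-lub p bound = foldr-⊔-lub _ (bound (≼-refl , p))
  (Allₚ.map⁺ (All.tabulate λ m → bound (∈-path⁻ p m)))

pathCost-suffix : ∀ {t} {v x i : Pos t} → v ≼ x → (q : x ≼ i) (r : v ≼ i) → pathCost q ≤ pathCost r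
pathCost-suffix v≼x q r = pathCost-lub q λ (x≼u , u≼i) → costAt≤pathCost r (≼-trans v≼x x≼u , u≼i)

module SMaximality {T : Tree} (w₀ : ℚ) where

  -- The vertices of T[v,x) are all cheaper than the s-maximal x.
  pathCost-sMaximal : ∀ {v x j : Pos T} → SMax w₀ v x → (q : x ≼ j) (r : v ≼ j) →
    pathCost r ≤ pathCost q
  pathCost-sMaximal {x = x} (v≼x , cheaper) q r = pathCost-lub r bound
    where
    bound : ∀ {u} → Between _ _ u → costAt u ≤ pathCost q
    bound {u} (v≼u , u≼j) with x ≼? u
    ... | yes x≼u = costAt≤pathCost q (x≼u , u≼j)
    ... | no x⋠u with ≼-comparable q u≼j
    ...   | inj₁ x≼u = contradiction x≼u x⋠u
    ...   | inj₂ u≼x = ℚₚ.≤-trans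
      (ℚₚ.<⇒≤ (cheaper u (∈-pathP⁺ v≼x (v≼u , u≼x) λ { refl → x⋠u ≼-refl })))
      (costAt≤pathCost q (≼-refl , q))

  SMax? : (v : Pos T) → Decidable (SMax w₀ v)
  SMax? v y with v ≼? y
  ... | no v⋠y = no (v⋠y ∘ proj₁)
  ... | yes v≼y = Dec.map′ (λ c → v≼y , λ p m → All.lookup c m)
    (λ { (v≼y′ , c) → All.tabulate λ m → c _ (subst (λ r → _ ∈ pathP r) (≼-irrelevant v≼y v≼y′) m) })
    (All.all? (λ p → costAt p ℚₚ.<? costAt y) (pathP v≼y))

  SMax-root : ∀ {v : Pos T} → SMax w₀ v v
  SMax-root {v} = ≼-refl , λ p m →
    let (v≼p , p≼v) , p≢v = ∈-pathP⁻ (≼-refl {x = v}) m in contradiction (≼-antisym p≼v v≼p) p≢v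

  deepestSMax : ∀ {v i : Pos T} → v ≼ i →
    Σ[ x ∈ Pos T ] (SMax w₀ v x × x ≼ i) × (∀ {y} → SMax w₀ v y → y ≼ i → y ≼ x)
  deepestSMax {v} {i} v≼i = x , x-ok , deepest
    where
    open Data.List.Extrema ℕₚ.≤-totalOrder using (argmax; f[xs]≤f[argmax])
    Candidate? : Decidable (λ y → SMax w₀ v y × y ≼ i)
    Candidate? y = SMax? v y Dec.×-dec (y ≼? i)
    candidates = witnesses Candidate? (anc i)
    best = argmax (depth ∘ proj₁) (v , SMax-root , v≼i) candidates
    x = proj₁ best
    x-ok = proj₂ best
    deepest : ∀ {y} → SMax w₀ v y → y ≼ i → y ≼ x
    deepest {y} sy y≼i with ≼-comparable y≼i (proj₂ x-ok)
    ... | inj₁ y≼x = y≼x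
    ... | inj₂ x≼y =
      let _ , m = ∈-witnesses Candidate? (∈-anc⁺ y≼i) (sy , y≼i)
          y≤x = All.lookup (f[xs]≤f[argmax] {f = depth ∘ proj₁} _ candidates) m
      in subst (_≼ x) (≼∧depth≥⇒≡ x≼y y≤x) ≼-refl

  InH⇒≼∧InWin : ∀ {v x j : Pos T} → InH w₀ v x j → InWin w₀ v x → x ≼ j × InWin w₀ v j
  InH⇒≼∧InWin (inj₁ refl)                    wx = ≼-refl , wx
  InH⇒≼∧InWin (inj₂ ((wj , _) , v≼j , x∈ , _)) _  = proj₂ (proj₁ (∈-pathP⁻ v≼j x∈)) , wj

module Windows {T : Tree} (w₀ : ℚ) (weights-nonneg : ∀ (p : Pos T) → 0ℚ ≤ weightAt p) where

  open SMaximality {T} w₀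

  pathWeight-trans : ∀ {x y z : Pos T} (p : x ≼ y) (q : y ≼ z) →
    pathWeight (≼-trans p q) ≡ sumℚ (map weightAt (pathP p)) + pathWeight q
  pathWeight-trans p q = begin
    sumℚ (map weightAt (path (≼-trans p q)))          ≡⟨ cong (sumℚ ∘ map weightAt) (path-trans p q) ⟩
    sumℚ (map weightAt (pathP p ++ path q))            ≡⟨ cong sumℚ (map-++ weightAt (pathP p) _) ⟩
    sumℚ (map weightAt (pathP p) ++ map weightAt (path q)) ≡⟨ sumℚ-++ (map weightAt (pathP p)) _ ⟩
    sumℚ (map weightAt (pathP p)) + pathWeight q        ∎
    where open ≡-Reasoning

  all-weights-nonneg : ∀ xs → All (0ℚ ≤_) (map weightAt xs)
  all-weights-nonneg xs = Allₚ.map⁺ (All.tabulate λ {p} _ → weights-nonneg p)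

  pathWeight-suffix : ∀ {v x i : Pos T} (p : v ≼ x) (q : x ≼ i) (r : v ≼ i) →
    pathWeight q ≤ pathWeight r
  pathWeight-suffix p q r = begin
    pathWeight q                                 ≡⟨ ℚₚ.+-identityˡ (pathWeight q) ⟨
    0ℚ + pathWeight q                            ≤⟨ ℚₚ.+-monoˡ-≤ (pathWeight q)
                                                      (sumℚ-nonneg (all-weights-nonneg (pathP p))) ⟩
    sumℚ (map weightAt (pathP p)) + pathWeight q ≡⟨ pathWeight-trans p q ⟨
    pathWeight (≼-trans p q)                     ≡⟨ cong pathWeight (≼-irrelevant (≼-trans p q) r) ⟩
    pathWeight r                                 ∎
    where open ℚₚ.≤-Reasoning

  pathWeight-prefix : ∀ {v x i : Pos T} (p : v ≼ x) (q : x ≼ i) (r : v ≼ i) →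
    pathWeight p ≤ pathWeight r
  pathWeight-prefix {x = x} p q r = begin
    pathWeight p                                 ≡⟨ cong pathWeight (≼-irrelevant p (≼-trans p ≼-refl)) ⟩
    pathWeight (≼-trans p ≼-refl)                ≡⟨ pathWeight-trans p ≼-refl ⟩
    P + pathWeight (≼-refl {x = x})              ≡⟨ cong (λ l → P + sumℚ (map weightAt l)) (path-refl {x = x}) ⟩
    P + (weightAt x + 0ℚ)                        ≡⟨ cong (P +_) (ℚₚ.+-identityʳ (weightAt x)) ⟩
    P + weightAt x                               ≤⟨ ℚₚ.+-monoʳ-≤ P x≤q ⟩
    P + pathWeight q                             ≡⟨ pathWeight-trans p q ⟨
    pathWeight (≼-trans p q)                     ≡⟨ cong pathWeight (≼-irrelevant (≼-trans p q) r) ⟩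
    pathWeight r                                 ∎
    where
    open ℚₚ.≤-Reasoning
    P = sumℚ (map weightAt (pathP p))
    x≤q = ∈⇒≤sumℚ (all-weights-nonneg (path q)) (∈-map⁺ weightAt (∈-path⁺ q (≼-refl , q)))

  InWin-suffix : ∀ {v x i : Pos T} → v ≼ x → x ≼ i → InWin w₀ v i → InWin w₀ x i
  InWin-suffix v≼x x≼i (v≼i , light) = x≼i , ℚₚ.≤-trans (pathWeight-suffix v≼x x≼i v≼i) light

  InWin-prefix : ∀ {v x i : Pos T} → v ≼ x → x ≼ i → InWin w₀ v i → InWin w₀ v x
  InWin-prefix v≼x x≼i (v≼i , light) = v≼x , ℚₚ.≤-trans (pathWeight-prefix v≼x x≼i v≼i) light

  InWin⇒InH : ∀ {v i : Pos T} → InWin w₀ v i → Σ[ x ∈ Pos T ] InWinStar w₀ v x × x ≼ i × InH w₀ v x i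
  InWin⇒InH {v} {i} wi@(v≼i , _) with SMax? v i
  ... | yes si = i , (wi , si) , ≼-refl , inj₁ refl
  ... | no ¬si =
    let x , (sx , x≼i) , deepest = deepestSMax v≼i
        x∈ = ∈-pathP⁺ v≼i (proj₁ sx , x≼i) λ x≡i → ¬si (subst (SMax w₀ v) x≡i sx)
        next = λ y m sy → deepest sy (proj₂ (proj₁ (∈-pathP⁻ v≼i m)))
    in x , (InWin-prefix (proj₁ sx) x≼i wi , sx) , x≼i , inj₂ ((wi , ¬si) , v≼i , x∈ , sx , next)

module _ {t : Tree} {v x : Pos t} (v≼x : v ≼ x) where

  Rest∩Subtree : ∀ {i} → x ≼ i → Rest v i ∩ Subtree x ≐ Rest x i
  Rest∩Subtree x≼i =
    (λ ((v≼u , ∉vi) , x≼u) → x≼u , λ (_ , u≼i) → ∉vi (v≼u , u≼i)) ,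
    (λ (x≼u , ∉xi) → (≼-trans v≼x x≼u , λ (_ , u≼i) → ∉xi (x≼u , u≼i)) , x≼u)

  Rest∪Rest∖Subtree : ∀ {i j} → x ≼ i → x ≼ j → Rest x j ∪ (Rest v i ∩ ∁ (Subtree x)) ≐ Rest v j
  Rest∪Rest∖Subtree {i} {j} x≼i x≼j = to , from
    where
    to : Rest x j ∪ (Rest v i ∩ ∁ (Subtree x)) ⊆ Rest v j
    to (inj₁ (x≼u , ∉xj)) = ≼-trans v≼x x≼u , λ (_ , u≼j) → ∉xj (x≼u , u≼j)
    to (inj₂ ((v≼u , ∉vi) , x⋠u)) = v≼u , λ (_ , u≼j) →
      [ (λ u≼x → ∉vi (v≼u , ≼-trans u≼x x≼i)) , x⋠u ]′ (≼-comparable u≼j x≼j)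
    from : Rest v j ⊆ Rest x j ∪ (Rest v i ∩ ∁ (Subtree x))
    from {u} (v≼u , ∉vj) with x ≼? u
    ... | yes x≼u = inj₁ (x≼u , λ (_ , u≼j) → ∉vj (v≼u , u≼j))
    ... | no x⋠u = inj₂ ((v≼u , λ (_ , u≼i) →
      [ (λ u≼x → ∉vj (v≼u , ≼-trans u≼x x≼j)) , x⋠u ]′ (≼-comparable u≼i x≼i)) , x⋠u)

  -- A segment avoiding T[v,i] cannot straddle x ∈ T[v,i].
  Between⊆Rest⇒inside⊎outside : ∀ {i s e} → x ≼ i → Between s e ⊆ Rest v i →
    Between s e ⊆ Subtree x ⊎ Between s e ⊆ ∁ (Subtree x)
  Between⊆Rest⇒inside⊎outside {s = s} x≼i s-e⊆Rest with x ≼? s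
  ... | yes x≼s = inj₁ λ (s≼u , _) → ≼-trans x≼s s≼u
  ... | no x⋠s = inj₂ λ (s≼u , u≼e) x≼u →
    [ x⋠s , (λ s≼x → proj₂ (s-e⊆Rest (s≼x , ≼-trans x≼u u≼e)) (v≼x , x≼i)) ]′ (≼-comparable x≼u s≼u)

module Partitions {T : Tree} (w₀ : ℚ) where

  record Segment : Set where
    constructor segment
    field
      {start end} : Pos T
      start≼end   : start ≼ end

  open Segment public

  _∋_ : Segment → Pos T → Set
  c ∋ u = Between (start c) (end c) u

  segCost : Segment → ℚ
  segCost c = pathCost (start≼end c)

  Light : Segment → Set
  Light c = pathWeight (start≼end c) ≤ w₀

  -- ChainPartition is the case S = T_y; other sets arise as the rest T_y ∖ T[y,j] of a partition.
  record Partition (S : Pred (Pos T) 0ℓ) : Set where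
    field
      segments   : List Segment
      all-light  : All Light segments
      all-inside : All (λ c → (c ∋_) ⊆ S) segments
      covers     : ∀ {u} → S u → ExactlyOne (_∋ u) segments

  open Partition public

  cost : ∀ {S} → Partition S → ℚ
  cost R = sumℚ (map segCost (segments R))

  ∅-partition : ∀ {S} → Empty S → Partition S
  ∅-partition ∅ = record
    { segments = [] ; all-light = [] ; all-inside = [] ; covers = λ {u} su → contradiction su (∅ u) }

  cost-∅ : ∀ {S} → Empty S → (Q : Partition S) → cost Q ≡ 0ℚ
  cost-∅ ∅ Q with segments Q | all-inside Q
  ... | []    | []      = refl
  ... | c ∷ _ | c⊆S ∷ _ = contradiction (c⊆S (≼-refl , start≼end c)) (∅ _)

  cons : ∀ {S} (c : Segment) → Light c → (c ∋_) ⊆ S → Partition (S ∩ ∁ (c ∋_)) → Partition S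
  cons {S} c c-light c⊆S R = record
    { segments   = c ∷ segments R
    ; all-light  = c-light ∷ all-light R
    ; all-inside = c⊆S ∷ All.map (λ c′⊆ {_} c′∋u → proj₁ (c′⊆ c′∋u)) (all-inside R)
    ; covers     = cover
    }
    where
    cover : ∀ {u} → S u → ExactlyOne (_∋ u) (c ∷ segments R)
    cover {u} su with Between? (start c) (end c) u
    ... | yes c∋u = hit c∋u (All.map (λ c′⊆ c′∋u → proj₂ (c′⊆ c′∋u) c∋u) (all-inside R))
    ... | no c∌u  = miss c∌u (covers R (su , c∌u))

  remove : ∀ {S c} (R : Partition S) → c ∈ segments R →
    Σ[ R′ ∈ Partition (S ∩ ∁ (c ∋_)) ] cost R ≡ segCost c + cost R′
  remove {S} {c} R c∈ with xs , ys , eq ← ∈-∃++ c∈ = R′ , cost-eq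
    where
    inside : All (λ c → (c ∋_) ⊆ S) (xs ++ c ∷ ys)
    inside = subst (All (λ c → (c ∋_) ⊆ S)) eq (all-inside R)
    cover : ∀ {u} → S u → ExactlyOne (_∋ u) (xs ++ c ∷ ys)
    cover {u} su = subst (ExactlyOne (_∋ u)) eq (covers R su)
    R′ : Partition (S ∩ ∁ (c ∋_))
    R′ = record
      { segments   = xs ++ ys
      ; all-light  = All-remove xs (subst (All Light) eq (all-light R))
      ; all-inside = All.tabulate λ m {_} c′∋u →
          let su = All.lookup (All-remove xs inside) m c′∋u
          in su , λ c∋u → All.lookup (exactlyOne-others xs (cover su) c∋u) m c′∋u
      ; covers     = λ (su , c∌u) → exactlyOne-remove xs (cover su) c∌u
      }
    cost-eq : cost R ≡ segCost c + cost R′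
    cost-eq = begin
      sumℚ (map segCost (segments R))                        ≡⟨ cong (sumℚ ∘ map segCost) eq ⟩
      sumℚ (map segCost (xs ++ c ∷ ys))                      ≡⟨ cong sumℚ (map-++ segCost xs (c ∷ ys)) ⟩
      sumℚ (map segCost xs ++ segCost c ∷ map segCost ys)    ≡⟨ sumℚ-middle (map segCost xs) _ _ ⟩
      segCost c + sumℚ (map segCost xs ++ map segCost ys)    ≡⟨ cong ((segCost c +_) ∘ sumℚ)
                                                                     (map-++ segCost xs ys) ⟨
      segCost c + cost R′                                    ∎
      where open ≡-Reasoning

  glue : ∀ {A B} → Partition A → Partition B → Empty (A ∩ B) → Partition (A ∪ B)
  glue R₁ R₂ disjoint = record
    { segments   = segments R₁ ++ segments R₂
    ; all-light  = Allₚ.++⁺ (all-light R₁) (all-light R₂)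
    ; all-inside = Allₚ.++⁺ (All.map (λ c⊆A {_} c∋u → inj₁ (c⊆A c∋u)) (all-inside R₁))
                            (All.map (λ c⊆B {_} c∋u → inj₂ (c⊆B c∋u)) (all-inside R₂))
    ; covers     = λ
      { {u} (inj₁ a) → exactlyOne-++⁺ˡ (covers R₁ a)
          (All.map (λ c⊆B c∋u → disjoint u (a , c⊆B c∋u)) (all-inside R₂))
      ; {u} (inj₂ b) → exactlyOne-++⁺ʳ
          (All.map (λ c⊆A c∋u → disjoint u (c⊆A c∋u , b)) (all-inside R₁)) (covers R₂ b) }
    }

  cost-glue : ∀ {A B} (R₁ : Partition A) (R₂ : Partition B) disjoint →
    cost (glue R₁ R₂ disjoint) ≡ cost R₁ + cost R₂
  cost-glue R₁ R₂ _ = trans (cong sumℚ (map-++ segCost (segments R₁) (segments R₂)))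
                            (sumℚ-++ (map segCost (segments R₁)) _)

  transport : ∀ {S S′} → S ≐ S′ → Partition S → Partition S′
  transport (S⊆S′ , S′⊆S) R = record
    { segments   = segments R
    ; all-light  = all-light R
    ; all-inside = All.map (λ c⊆S {_} c∋u → S⊆S′ (c⊆S c∋u)) (all-inside R)
    ; covers     = λ su → covers R (S′⊆S su)
    }

  select : ∀ {S X} {G : Pred Segment 0ℓ} (G? : Decidable G) (R : Partition S) →
    (∀ {c} → (c ∋_) ⊆ S → G c → (c ∋_) ⊆ X) →
    (∀ {c u} → (c ∋_) ⊆ S → c ∋ u → X u → G c) →
    Partition (S ∩ X)
  select G? R selected⊆X meets-X⇒selected = record
    { segments   = filter G? (segments R)
    ; all-light  = Allₚ.filter⁺ G? (all-light R)
    ; all-inside = All.tabulate λ {c} m {_} c∋u →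
        let c⊆S = All.lookup (Allₚ.filter⁺ G? (all-inside R)) m
        in c⊆S c∋u , selected⊆X {c} c⊆S (All.lookup (Allₚ.all-filter G? (segments R)) m) c∋u
    ; covers     = λ (su , xu) → exactlyOne-filter⁺ G?
        (All.tabulate λ {c} m c∋u → meets-X⇒selected {c} (All.lookup (all-inside R) m) c∋u xu)
        (covers R su)
    }

  split : ∀ {S F} (F? : Decidable F) (R : Partition S) →
    (∀ c → (c ∋_) ⊆ S → (c ∋_) ⊆ F ⊎ (c ∋_) ⊆ ∁ F) →
    Σ[ R₁ ∈ Partition (S ∩ F) ] Σ[ R₂ ∈ Partition (S ∩ ∁ F) ] cost R ≡ cost R₁ + cost R₂
  split {S} {F} F? R homogeneous =
    select G? R (λ {c} → inside {c}) (λ {c} → meets-inside {c}) ,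
    select (∁? G?) R (λ {c} → outside {c}) (λ {c} → meets-outside {c}) ,
    sumℚ-filter G? segCost (segments R)
    where
    G? : Decidable (F ∘ start)
    G? = F? ∘ start
    start∈ : ∀ c → c ∋ start c
    start∈ c = ≼-refl , start≼end c
    inside : ∀ {c} → (c ∋_) ⊆ S → F (start c) → (c ∋_) ⊆ F
    inside {c} c⊆S f with homogeneous c c⊆S
    ... | inj₁ c⊆F  = c⊆F
    ... | inj₂ c⊆∁F = contradiction f (c⊆∁F (start∈ c))
    outside : ∀ {c} → (c ∋_) ⊆ S → ¬ F (start c) → (c ∋_) ⊆ ∁ F
    outside {c} c⊆S ¬f with homogeneous c c⊆S
    ... | inj₁ c⊆F  = contradiction (c⊆F (start∈ c)) ¬f
    ... | inj₂ c⊆∁F = c⊆∁F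
    meets-inside : ∀ {c u} → (c ∋_) ⊆ S → c ∋ u → F u → F (start c)
    meets-inside {c} c⊆S c∋u fu = Dec.decidable-stable (G? c) λ ¬f → outside {c} c⊆S ¬f c∋u fu
    meets-outside : ∀ {c u} → (c ∋_) ⊆ S → c ∋ u → ¬ F u → ¬ F (start c)
    meets-outside {c} c⊆S c∋u ¬fu f = ¬fu (inside {c} c⊆S f c∋u)

  toSegment : ∀ {y} → Chain w₀ y → Segment
  toSegment c = segment (ord c)

  fromChainPartition : ∀ {y} → ChainPartition w₀ y → Partition (Subtree y)
  fromChainPartition Q = record
    { segments   = map toSegment (chains Q)
    ; all-light  = Allₚ.map⁺ (light Q)
    ; all-inside = Allₚ.map⁺ (All.tabulate λ {c} _ {_} (top≼u , _) → ≼-trans (below c) top≼u)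
    ; covers     = λ {u} y≼u → exactlyOne-map⁺ toSegment
        (exactlyOne-map (λ {c} → ∈-path⁻ (ord c)) (λ {c} → ∈-path⁺ (ord c))
          (uniqueIndex⇒exactlyOne (chains Q) (exact Q u y≼u)))
    }

  cost-fromChainPartition : ∀ {y} (Q : ChainPartition w₀ y) →
    cost (fromChainPartition Q) ≡ partitionCost w₀ Q
  cost-fromChainPartition Q = cong sumℚ (sym (map-∘ (chains Q)))

  toChains : ∀ {y} (cs : List Segment) → All (λ c → (c ∋_) ⊆ Subtree y) cs → List (Chain w₀ y)
  toChains []       []          = []
  toChains (c ∷ cs) (c⊆ ∷ cs⊆) =
    chain (start c) (end c) (c⊆ (≼-refl , start≼end c)) (start≼end c) ∷ toChains cs cs⊆

  map-toSegment-toChains : ∀ {y} cs (cs⊆ : All (λ c → (c ∋_) ⊆ Subtree y) cs) →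
    map toSegment (toChains cs cs⊆) ≡ cs
  map-toSegment-toChains []       []         = refl
  map-toSegment-toChains (c ∷ cs) (_ ∷ cs⊆) = cong (c ∷_) (map-toSegment-toChains cs cs⊆)

  toChainPartition : ∀ {y} → Partition (Subtree y) → ChainPartition w₀ y
  toChainPartition R = record
    { chains = toChains (segments R) (all-inside R)
    ; light  = Allₚ.map⁻ (subst (All Light) (sym eq) (all-light R))
    ; exact  = λ u y≼u → exactlyOne⇒uniqueIndex
        (exactlyOne-map (λ {c} → ∈-path⁺ (ord c)) (λ {c} → ∈-path⁻ (ord c))
          (exactlyOne-map⁻ toSegment (subst (ExactlyOne (_∋ u)) (sym eq) (covers R y≼u))))
    }
    where
    eq : map toSegment (toChains (segments R) (all-inside R)) ≡ segments R
    eq = map-toSegment-toChains (segments R) (all-inside R)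

  cost-toChainPartition : ∀ {y} (R : Partition (Subtree y)) →
    partitionCost w₀ (toChainPartition R) ≡ cost R
  cost-toChainPartition R = trans (cong sumℚ (map-∘ chs))
    (cong (sumℚ ∘ map segCost) (map-toSegment-toChains (segments R) (all-inside R)))
    where
    chs : List (Chain w₀ _)
    chs = toChains (segments R) (all-inside R)

  decompose : ∀ {y j} (Q : ChainPartition w₀ y) → HasChain w₀ Q j →
    Σ[ y≼j ∈ y ≼ j ] pathWeight y≼j ≤ w₀ ×
      Σ[ R ∈ Partition (Rest y j) ] partitionCost w₀ Q ≡ pathCost y≼j + cost R
  decompose Q has with c , c∈ , refl , refl ← find has =
    let R , eq = remove (fromChainPartition Q) (∈-map⁺ toSegment c∈)
    in ord c , All.lookup (light Q) c∈ , R , trans (sym (cost-fromChainPartition Q)) eq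

  compose : ∀ {y j} (y≼j : y ≼ j) → pathWeight y≼j ≤ w₀ → (R : Partition (Rest y j)) →
    Σ[ Q ∈ ChainPartition w₀ y ] HasChain w₀ Q j × partitionCost w₀ Q ≡ pathCost y≼j + cost R
  compose y≼j y-j-light R = toChainPartition R′ , here (refl , refl) , cost-toChainPartition R′
    where
    R′ : Partition (Subtree _)
    R′ = cons (segment y≼j) y-j-light proj₁ R

  rootChain : ∀ {v} (Q : ChainPartition w₀ v) → Σ[ i ∈ Pos T ] InWin w₀ v i × HasChain w₀ Q i
  rootChain {v} Q with k , v∈ , _ ← exact Q v ≼-refl =
    bot c , window c top≡v (All.lookup (light Q) (∈-lookup k)) , lose (∈-lookup k) (top≡v , refl)
    where
    c : Chain w₀ v
    c = lookup (chains Q) k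
    top≡v : top c ≡ v
    top≡v = ≼-antisym (proj₁ (∈-path⁻ (ord c) v∈)) (below c)
    window : (c : Chain w₀ v) → top c ≡ v → chainWeight w₀ c ≤ w₀ → InWin w₀ v (bot c)
    window (chain _ _ _ top≼bot) refl c-light = top≼bot , c-light

  IsCost⇒≤ : ∀ {x i c} → IsCost w₀ x i c → (x≼i : x ≼ i) → pathWeight x≼i ≤ w₀ →
    (R : Partition (Rest x i)) → c ≤ pathCost x≼i + cost R
  IsCost⇒≤ {c = c} (_ , minimal) x≼i x-i-light R =
    let Q , has , eq = compose x≼i x-i-light R in subst (c ≤_) eq (minimal Q has)

  IsCost⇒decomposition : ∀ {x i c} → IsCost w₀ x i c →
    Σ[ x≼i ∈ x ≼ i ] Σ[ R ∈ Partition (Rest x i) ] c ≡ pathCost x≼i + cost R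
  IsCost⇒decomposition ((Q , has , refl) , _) = let x≼i , _ , R , eq = decompose Q has in x≼i , R , eq

module OptimalPartitions {T : Tree} (w₀ : ℚ) (weights≤w₀ : ∀ (p : Pos T) → weightAt p ≤ w₀) where

  open Partitions {T} w₀

  Optimal : ∀ {S} → Partition S → Set
  Optimal {S} R = ∀ (Q : Partition S) → cost R ≤ cost Q

  size : ∀ {S : Pred (Pos T) 0ℓ} → Decidable S → ℕ
  size S? = length (filter S? (positions T))

  topmost : ∀ {S : Pred (Pos T) 0ℓ} → Decidable S → ∀ {u} → S u →
    Σ[ r ∈ Pos T ] S r × (∀ {a} → S a → a ≼ r → a ≡ r)
  topmost {S} S? {u} su = proj₁ best , proj₂ best , λ {a} sa a≼r →
    let _ , m = ∈-witnesses S? (∈-positions a) sa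
    in ≼∧depth≥⇒≡ a≼r (All.lookup (f[argmin]≤f[xs] {f = depth ∘ proj₁} _ members) m)
    where
    open Data.List.Extrema ℕₚ.≤-totalOrder using (argmin; f[argmin]≤f[xs])
    members : List (Σ (Pos T) S)
    members = witnesses S? (positions T)
    best : Σ (Pos T) S
    best = argmin (depth ∘ proj₁) (u , su) members

  singleton-light : ∀ {r : Pos T} → pathWeight (≼-refl {x = r}) ≤ w₀
  singleton-light {r} = subst (_≤ w₀)
    (sym (trans (cong (sumℚ ∘ map weightAt) (path-refl {x = r})) (ℚₚ.+-identityʳ (weightAt r))))
    (weights≤w₀ r)

  Extension : Pred (Pos T) 0ℓ → Pos T → Pred (Pos T) 0ℓ
  Extension S r j = Σ[ r≼j ∈ r ≼ j ] pathWeight r≼j ≤ w₀ × Between r j ⊆ S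

  Extension? : ∀ {S} → Decidable S → ∀ r → Decidable (Extension S r)
  Extension? S? r j with r ≼? j
  ... | no r⋠j = no (r⋠j ∘ proj₁)
  ... | yes r≼j = Dec.map′
    (λ (r-j-light , all-S) → r≼j , r-j-light , λ b → All.lookup all-S (∈-path⁺ r≼j b))
    (λ (r≼j′ , r-j-light , ⊆S) →
      subst (λ p → pathWeight p ≤ w₀) (≼-irrelevant r≼j′ r≼j) r-j-light ,
      All.tabulate λ m → ⊆S (∈-path⁻ r≼j m))
    ((pathWeight r≼j ℚₚ.≤? w₀) Dec.×-dec All.all? S? (path r≼j))

  -- Every partition of S has a segment through r, which must start at r since r is topmost.
  optimal-from-topmost : ∀ {S r} → Decidable S → S r → (∀ {a} → S a → a ≼ r → a ≡ r) →
    (∀ {j} (r≼j : r ≼ j) → pathWeight r≼j ≤ w₀ → Between r j ⊆ S →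
      Σ[ R ∈ Partition (S ∩ ∁ (Between r j)) ] Optimal R) →
    Σ[ R ∈ Partition S ] Optimal R
  optimal-from-topmost {S} {r} S? sr r-topmost optimal-rest = extend best , optimal
    where
    open Data.List.Extrema (DecTotalOrder.totalOrder ℚₚ.≤-decTotalOrder) using (argmin; f[argmin]≤f[xs])
    extend : Σ (Pos T) (Extension S r) → Partition S
    extend (_ , r≼j , r-j-light , ⊆S) =
      cons (segment r≼j) r-j-light ⊆S (proj₁ (optimal-rest r≼j r-j-light ⊆S))
    candidates : List (Σ (Pos T) (Extension S r))
    candidates = witnesses (Extension? S? r) (positions T)
    trivial : Σ (Pos T) (Extension S r)
    trivial = r , ≼-refl , singleton-light {r} , λ (r≼u , u≼r) → subst S (≼-antisym r≼u u≼r) sr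
    best : Σ (Pos T) (Extension S r)
    best = argmin (cost ∘ extend) trivial candidates
    through : ∀ (Q : Partition S) {c} → c ∈ segments Q → c ∋ r → cost (extend best) ≤ cost Q
    through Q {segment {a} {j} a≼j} c∈ (a≼r , r≼j)
      with refl ← r-topmost (All.lookup (all-inside Q) c∈ (≼-refl , a≼j)) a≼r =
      let R′ , eq = remove Q c∈
          (r≼j′ , l′ , ⊆S′) , m = ∈-witnesses (Extension? S? r) (∈-positions j)
            (a≼j , All.lookup (all-light Q) c∈ , All.lookup (all-inside Q) c∈)
          R″ , R″-optimal = optimal-rest r≼j′ l′ ⊆S′
      in begin
        cost (extend best)      ≤⟨ All.lookup (f[argmin]≤f[xs] {f = cost ∘ extend} _ candidates) m ⟩
        pathCost r≼j′ + cost R″ ≤⟨ ℚₚ.+-monoʳ-≤ (pathCost r≼j′) (R″-optimal R′) ⟩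
        pathCost r≼j′ + cost R′ ≡⟨ cong (λ p → pathCost p + cost R′) (≼-irrelevant r≼j′ a≼j) ⟩
        pathCost a≼j + cost R′  ≡⟨ eq ⟨
        cost Q                  ∎
      where open ℚₚ.≤-Reasoning
    optimal : Optimal (extend best)
    optimal Q = let _ , c∈ , c∋r = find (exactlyOne⇒Any (covers Q sr)) in through Q c∈ c∋r

  optimalPartition : ∀ {S : Pred (Pos T) 0ℓ} → Decidable S → Σ[ R ∈ Partition S ] Optimal R
  optimalPartition S? = go (suc (size S?)) S? ℕₚ.≤-refl
    where
    go : ∀ n {S : Pred (Pos T) 0ℓ} (S? : Decidable S) → size S? ℕ.< n → Σ[ R ∈ Partition S ] Optimal R
    go (suc n) {S} S? size<n with Any.any? S? (positions T)
    ... | no none = ∅-partition ∅ , λ Q → ℚₚ.≤-reflexive (sym (cost-∅ ∅ Q))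
      where
      ∅ : Empty S
      ∅ u su = none (lose (∈-positions u) su)
    ... | yes some =
      let u , _ , su = find some
          r , sr , r-topmost = topmost S? su
      in optimal-from-topmost S? sr r-topmost λ {j} r≼j _ _ →
        let S′? = λ u → S? u Dec.×-dec Dec.¬? (Between? r j u)
        in go n S′? (ℕₚ.<-≤-trans
             (length-filter-< S? S′? proj₁ (positions T) (∈-positions r) sr λ (_ , ∉) → ∉ (≼-refl , r≼j))
             (ℕₚ.≤-pred size<n))

  IsCost-of-optimal : ∀ {x i} (x≼i : x ≼ i) → pathWeight x≼i ≤ w₀ →
    (R : Partition (Rest x i)) → Optimal R → IsCost w₀ x i (pathCost x≼i + cost R)
  IsCost-of-optimal x≼i x-i-light R R-optimal with Q , has , eq ← compose x≼i x-i-light R =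
    (Q , has , eq) , λ Q′ has′ →
      let x≼i′ , _ , R′ , eq′ = decompose Q′ has′
      in begin
        pathCost x≼i + cost R    ≤⟨ ℚₚ.+-monoʳ-≤ (pathCost x≼i) (R-optimal R′) ⟩
        pathCost x≼i + cost R′   ≡⟨ cong (λ p → pathCost p + cost R′) (≼-irrelevant x≼i x≼i′) ⟩
        pathCost x≼i′ + cost R′  ≡⟨ eq′ ⟨
        partitionCost w₀ Q′      ∎
    where open ℚₚ.≤-Reasoning

  IsCost-exists : ∀ {x i} → InWin w₀ x i → ∃ (IsCost w₀ x i)
  IsCost-exists {x} {i} (x≼i , x-i-light) =
    let R , R-optimal = optimalPartition (Rest? x i)
    in _ , IsCost-of-optimal x≼i x-i-light R R-optimal

module Rerouting {T : Tree} (w₀ : ℚ) where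

  open Partitions {T} w₀
  open SMaximality {T} w₀
  open ℚₚ.≤-Reasoning

  split-off-subtree : ∀ {v x i c} (v≼x : v ≼ x) (x≼i : x ≼ i) (v≼i : v ≼ i) → pathWeight x≼i ≤ w₀ →
    IsCost w₀ x i c → (R : Partition (Rest v i)) →
    Σ[ R₂ ∈ Partition (Rest v i ∩ ∁ (Subtree x)) ] c + cost R₂ ≤ pathCost v≼i + cost R
  split-off-subtree {x = x} {c = c} v≼x x≼i v≼i x-i-light xi-cost R
    with R₁ , R₂ , split-eq ← split (x ≼?_) R (λ _ → Between⊆Rest⇒inside⊎outside v≼x x≼i) =
    R₂ , (begin
      c + cost R₂                         ≤⟨ ℚₚ.+-monoˡ-≤ (cost R₂) (IsCost⇒≤ xi-cost x≼i x-i-light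
                                              (transport (Rest∩Subtree v≼x x≼i) R₁)) ⟩
      pathCost x≼i + cost R₁ + cost R₂    ≤⟨ ℚₚ.+-monoˡ-≤ (cost R₂) (ℚₚ.+-monoˡ-≤ (cost R₁)
                                              (pathCost-suffix v≼x x≼i v≼i)) ⟩
      pathCost v≼i + cost R₁ + cost R₂    ≡⟨ ℚₚ.+-assoc (pathCost v≼i) (cost R₁) (cost R₂) ⟩
      pathCost v≼i + (cost R₁ + cost R₂)  ≡⟨ cong (pathCost v≼i +_) split-eq ⟨
      pathCost v≼i + cost R               ∎)

  reroute : ∀ {v x i j c₁ c₂} → SMax w₀ v x → x ≼ i → x ≼ j → InWin w₀ v j →
    IsCost w₀ v j c₁ → IsCost w₀ x j c₂ → (R₂ : Partition (Rest v i ∩ ∁ (Subtree x))) →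
    c₁ ≤ c₂ + cost R₂
  reroute {v} {x} {i} {j} {c₁} {c₂} sx x≼i x≼j (v≼j , v-j-light) vj-cost xj-cost R₂
    with x≼j′ , Rx , xj-eq ← IsCost⇒decomposition xj-cost = begin
      c₁                                    ≤⟨ IsCost⇒≤ vj-cost v≼j v-j-light
                                                (transport (Rest∪Rest∖Subtree (proj₁ sx) x≼i x≼j) glued) ⟩
      pathCost v≼j + cost glued             ≡⟨ cong (pathCost v≼j +_) (cost-glue Rx R₂ disjoint) ⟩
      pathCost v≼j + (cost Rx + cost R₂)    ≤⟨ ℚₚ.+-monoˡ-≤ (cost Rx + cost R₂)
                                                (pathCost-sMaximal sx x≼j′ v≼j) ⟩
      pathCost x≼j′ + (cost Rx + cost R₂)   ≡⟨ ℚₚ.+-assoc (pathCost x≼j′) (cost Rx) (cost R₂) ⟨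
      pathCost x≼j′ + cost Rx + cost R₂     ≡⟨ cong (_+ cost R₂) xj-eq ⟨
      c₂ + cost R₂                          ∎
    where
    disjoint : Empty (Rest x j ∩ (Rest v i ∩ ∁ (Subtree x)))
    disjoint _ ((x≼u , _) , (_ , x⋠u)) = x⋠u x≼u
    glued : Partition (Rest x j ∪ (Rest v i ∩ ∁ (Subtree x)))
    glued = glue Rx R₂ disjoint

module Selection {T : Tree} (w₀ : ℚ)
  (weights-nonneg : ∀ (p : Pos T) → 0ℚ ≤ weightAt p)
  (weights≤w₀ : ∀ (p : Pos T) → weightAt p ≤ w₀)
  (v : Pos T) (ix : Pos T → Pos T)
  (ix∈H : ∀ x → InWinStar w₀ v x → InH w₀ v x (ix x))
  (ix-minimal : ∀ x → InWinStar w₀ v x → ∀ j → InH w₀ v x j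
    → ∀ c₁ c₂ → IsCost w₀ x (ix x) c₁ → IsCost w₀ x j c₂ → c₁ ≤ c₂)
  (a : Pos T)
  (a-minimal : ∀ x → InWinStar w₀ v x
    → ∀ c₁ c₂ → IsCost w₀ v a c₁ → IsCost w₀ v (ix x) c₂ → c₁ ≤ c₂)
  where

  open Partitions {T} w₀
  open OptimalPartitions {T} w₀ weights≤w₀
  open SMaximality {T} w₀
  open Windows {T} w₀ weights-nonneg
  open Rerouting {T} w₀

  exchange : ∀ {i c} → InWin w₀ v i → (v≼i : v ≼ i) (R : Partition (Rest v i)) →
    IsCost w₀ v a c → c ≤ pathCost v≼i + cost R
  exchange {i} {c} wi v≼i R a-cost =
    let x , (wx , sx) , x≼i , i∈H = InWin⇒InH wi
        v≼x = proj₁ sx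
        x≼j , wj = InH⇒≼∧InWin (ix∈H x (wx , sx)) wx
        cvj , vj-cost = IsCost-exists wj
        cxj , xj-cost = IsCost-exists (InWin-suffix v≼x x≼j wj)
        xi-window = InWin-suffix v≼x x≼i wi
        cxi , xi-cost = IsCost-exists xi-window
        R₂ , through-x = split-off-subtree v≼x x≼i v≼i (proj₂ xi-window) xi-cost R
    in begin
      c                      ≤⟨ a-minimal x (wx , sx) c cvj a-cost vj-cost ⟩
      cvj                    ≤⟨ reroute sx x≼i x≼j wj vj-cost xj-cost R₂ ⟩
      cxj + cost R₂          ≤⟨ ℚₚ.+-monoˡ-≤ (cost R₂)
                                  (ix-minimal x (wx , sx) i i∈H cxj cxi xj-cost xi-cost) ⟩
      cxi + cost R₂          ≤⟨ through-x ⟩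
      pathCost v≼i + cost R  ∎
    where open ℚₚ.≤-Reasoning

  a-minimal-in-window : ∀ i → InWin w₀ v i → ∀ c₁ c₂ → IsCost w₀ v a c₁ → IsCost w₀ v i c₂ → c₁ ≤ c₂
  a-minimal-in-window i wi c₁ c₂ a-cost i-cost =
    let v≼i , R , eq = IsCost⇒decomposition i-cost
    in subst (c₁ ≤_) (sym eq) (exchange wi v≼i R a-cost)

  a-optimal : ∀ c → IsCost w₀ v a c → IsMinPartitionCost w₀ v c
  a-optimal c a-cost@((P , _ , P-cost) , _) = (P , P-cost) , λ Q →
    let i , wi , has = rootChain Q
        v≼i , _ , R , eq = decompose Q has
    in subst (c ≤_) (sym eq) (exchange wi v≼i R a-cost)

lemma2 : (T : Tree) (w₀ : ℚ)
    → (∀ (p : Pos T) → 0ℚ ≤ weightAt p)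
    → (∀ (p : Pos T) → weightAt p ≤ w₀)
    → (v : Pos T)
    → (ix : Pos T → Pos T)
    → (∀ x → InWinStar w₀ v x → InH w₀ v x (ix x))
    → (∀ x → InWinStar w₀ v x → ∀ j → InH w₀ v x j
         → ∀ c₁ c₂ → IsCost w₀ x (ix x) c₁ → IsCost w₀ x j c₂ → c₁ ≤ c₂)
    → (a : Pos T)
    → Σ (Pos T) (λ x → InWinStar w₀ v x × (a ≡ ix x))
    → (∀ x → InWinStar w₀ v x
         → ∀ c₁ c₂ → IsCost w₀ v a c₁ → IsCost w₀ v (ix x) c₂ → c₁ ≤ c₂)
    → (∀ i → InWin w₀ v i
         → ∀ c₁ c₂ → IsCost w₀ v a c₁ → IsCost w₀ v i c₂ → c₁ ≤ c₂)
     × (∀ c → IsCost w₀ v a c → IsMinPartitionCost w₀ v c)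
lemma2 T w₀ weights-nonneg weights≤w₀ v ix ix∈H ix-minimal a _ a-minimal =
  a-minimal-in-window , a-optimal
  where open Selection w₀ weights-nonneg weights≤w₀ v ix ix∈H ix-minimal a a-minimal
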